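{- Let $n \ge 6$ and let $W_{1,n} = C_n + K_1$ be the wheel graph on $n+1$ vertices. Then $\dim(L(W_{1,n})) = n - \lceil n/3 \rceil$.
   Context: All graphs are finite, simple, undirected and connected. For a graph $H$, a set $W \subseteq V(H)$ is a resolving set if for every pair of distinct vertices $u,v \in V(H)$ there is $x \in W$ with $d(u,x) \ne d(v,x)$, where $d$ denotes the shortest-path distance. The metric dimension $\dim(H)$ is the minimum cardinality of a resolving set of $H$. The line graph $L(G)$ of $G$ has vertex set $E(G)$, two vertices being adjacent iff the corresponding edges of $G$ share an endpoint. $C_n + K_1$ denotes the join of the cycle $C_n$ with a single vertex (the hub), i.e. the hub is adjacent to every vertex of $C_n$. -}

module Defs where

open import Data.Nat using (ℕ; zero; suc; _+_; _≤_; _≡ᵇ_)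
open import Data.Fin using (Fin; toℕ) renaming (zero to fzero; suc to fsuc; _<_ to _<ᶠ_)
open import Data.Bool using (Bool; true; false; T; _∨_; _∧_)
open import Data.Product using (Σ; ∃; _×_; _,_)
open import Data.Sum using (_⊎_)
open import Data.List using (List; length)
open import Data.List.Membership.Propositional using (_∈_)
open import Data.List.Relation.Unary.Unique.Propositional using (Unique)
open import Relation.Binary.PropositionalEquality using (_≡_; _≢_)

record SGraph : Set₁ where
  field
    V   : Set
    Adj : V → V → Set
open SGraph public

data Walk (H : SGraph) : V H → V H → ℕ → Set where
  here : ∀ {u} → Walk H u u 0
  step : ∀ {u w v k} → Adj H u w → Walk H w v k → Walk H u v (suc k)

Dist : (H : SGraph) → V H → V H → ℕ → Set
Dist H u v k = Walk H u v k × (∀ m → Walk H u v m → k ≤ m)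

Resolving : (H : SGraph) → List (V H) → Set
Resolving H W = ∀ (u v : V H) → u ≢ v →
  ∃ λ x → x ∈ W × ∃ λ a → ∃ λ b → Dist H u x a × Dist H v x b × a ≢ b

MetricDim : SGraph → ℕ → Set
MetricDim H k =
  (∃ λ W → Unique W × Resolving H W × length W ≡ k) ×
  (∀ W → Unique W → Resolving H W → k ≤ length W)

record FinGraph : Set where
  field
    N   : ℕ
    adj : Fin N → Fin N → Bool
open FinGraph public

Edge : FinGraph → Set
Edge G = Σ (Fin (N G) × Fin (N G)) λ { (u , v) → (u <ᶠ v) × T (adj G u v) }

LineGraph : FinGraph → SGraph
LineGraph G = record
  { V   = Edge G
  ; Adj = λ { ((u , v) , _) ((x , y) , _) →
              ((u , v) ≢ (x , y)) × (u ≡ x ⊎ u ≡ y ⊎ v ≡ x ⊎ v ≡ y) }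
  }

-- Cycle C_n on Fin n: i ~ j iff j ≡ i+1 (mod n) or i ≡ j+1 (mod n).
cycAdj : (n : ℕ) → Fin n → Fin n → Bool
cycAdj n i j =
  ((suc (toℕ i) ≡ᵇ toℕ j) ∨ (suc (toℕ j) ≡ᵇ toℕ i)) ∨
  (((toℕ i ≡ᵇ 0) ∧ (suc (toℕ j) ≡ᵇ n)) ∨ ((toℕ j ≡ᵇ 0) ∧ (suc (toℕ i) ≡ᵇ n)))

-- Wheel W_{1,n} = C_n + K_1 on Fin (suc n): vertex 0 is the hub,
-- vertex (suc i) is the i-th cycle vertex.
wheelAdj : (n : ℕ) → Fin (suc n) → Fin (suc n) → Bool
wheelAdj n fzero    fzero    = false
wheelAdj n fzero    (fsuc _) = true
wheelAdj n (fsuc _) fzero    = true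
wheelAdj n (fsuc i) (fsuc j) = cycAdj n i j

Wheel : ℕ → FinGraph
Wheel n = record { N = suc n ; adj = wheelAdj n }

ceil3 : ℕ → ℕ
ceil3 n = Data.Nat._/_ (n + 2) 3

-- L(W_{1,n}) is the graph on the spokes s_a (hub to cycle vertex a) and the rims r_p (p to p + 1),
-- two of them adjacent when they share an endpoint.
--
-- Lower bound. If two cycle vertices a ≠ b lay on exactly the same landmarks, every landmark would be
-- equally far from s_a and s_b (distance 1 for spokes and for rims through the vertex, 2 for the other
-- rims), so these traces are pairwise distinct. A landmark contains at most two cycle vertices, at most
-- one trace is empty and a one-element trace determines its vertex. Hence two slots per cycle vertex can
-- be charged injectively to three slots per landmark plus two spare ones: 2n ≤ 3|W| + 2, that is
-- |W| ≥ ⌊2n/3⌋ = n − ⌈n/3⌉.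
--
-- Upper bound. Keep every rim r_p except those with p ≡ 2 (mod 3) and p = 3⌊n/3⌋. The omitted rims are
-- never two steps apart and contain at most one consecutive pair; for n ≥ 6 this is enough for the
-- ⌊2n/3⌋ remaining rims to resolve every pair of edges.

module Submission where

open import Defs

open import Data.Bool using (T; _∨_; _∧_)
open import Data.Bool.Properties using (T-∨; T-∧; T-irrelevant)
open import Data.Empty using (⊥; ⊥-elim)
open import Data.Fin using (Fin; toℕ; fromℕ<; inject₁; join; splitAt; combine; remQuot) renaming (zero to fzero; suc to fsuc)
open import Data.Fin.Patterns using (0F; 1F; 2F)
open import Data.Fin.Properties using (toℕ-fromℕ<; toℕ-injective; toℕ<n; splitAt-join; remQuot-combine; combine-remQuot; injective⇒≤) renaming (_≟_ to _≟ᶠ_)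
open import Data.List using (List; []; _∷_; length; map; _++_; allFin; lookup)
open import Data.List.Membership.Propositional using (_∈_)
open import Data.List.Membership.Propositional.Properties using (∈-map⁺; ∈-++⁺ˡ; ∈-++⁺ʳ; ∈-allFin)
open import Data.List.Properties using (length-map; length-++)
open import Data.List.Relation.Unary.All as All using (All; []; _∷_)
open import Data.List.Relation.Unary.AllPairs using (AllPairs; []; _∷_)
import Data.List.Relation.Unary.AllPairs.Properties as AllPairs
open import Data.List.Relation.Unary.Any using (Any; here; there; any?; index)
open import Data.List.Relation.Unary.Any.Properties using (lookup-index)
open import Data.List.Relation.Unary.Unique.Propositional using (Unique)
import Data.List.Relation.Unary.Unique.Propositional.Properties as Unique
open import Data.Maybe using (Maybe; just; nothing)
open import Data.Maybe.Properties using (just-injective)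
open import Data.Nat using (ℕ; zero; suc; _+_; _*_; _∸_; _≤_; _<_; _>_; z≤n; s≤s; _<?_; NonZero; >-nonZero; >-nonZero⁻¹; _%_; _/_; _≡ᵇ_)
open import Data.Nat.DivMod
open import Data.Nat.Divisibility using (divides)
open import Data.Nat.Properties
open import Data.Nat.Solver using (module +-*-Solver)
open +-*-Solver using (solve; _:+_; _:*_; con; _:=_)
open import Data.Product using (Σ; ∃; _×_; _,_; proj₁; proj₂; uncurry)
open import Data.Sum using (_⊎_; inj₁; inj₂; swap)
import Data.Sum as Sum
open import Data.Sum.Properties using (inj₁-injective)
open import Function using (case_of_; _∘_)
open import Function.Bundles using (Equivalence; _⇔_; mk⇔)
open import Relation.Binary using (tri<; tri≈; tri>)
open import Relation.Binary.PropositionalEquality using (_≡_; _≢_; refl; sym; trans; cong; cong₂; subst; subst₂; module ≡-Reasoning)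
open import Relation.Nullary using (¬_; Dec; yes; no; contradiction)
open import Relation.Nullary.Decidable using (_×-dec_; _⊎-dec_; ¬?; map′; True; False; toWitness; toWitnessFalse)
open import Relation.Unary using (Decidable)

-- Walks and distances

Minimum : (ℕ → Set) → ℕ → Set
Minimum P k = P k × (∀ m → P m → k ≤ m)

minimum-exists : ∀ {P : ℕ → Set} → Decidable P → ∀ {L} → P L → ∃ (Minimum P)
minimum-exists {P} P? {L} pL = search 0 L (λ _ ()) (subst P (sym (+-identityʳ L)) pL)
  where
  search : ∀ i d → (∀ m → m < i → ¬ P m) → P (d + i) → ∃ (Minimum P)
  search i d below p with P? i
  ... | yes pi = i , pi , λ m pm → ≮⇒≥ (λ m<i → below m m<i pm)
  search i zero below p | no ¬pi = contradiction p ¬pi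
  search i (suc d) below p | no ¬pi = search (suc i) d below′ (subst P (sym (+-suc d i)) p)
    where
    below′ : ∀ m → m < suc i → ¬ P m
    below′ m m<1+i with m<1+n⇒m<n∨m≡n m<1+i
    ... | inj₁ m<i = below m m<i
    ... | inj₂ refl = ¬pi

module _ {H : SGraph} where

  walk₀⇒≡ : ∀ {u v} → Walk H u v 0 → u ≡ v
  walk₀⇒≡ here = refl

  walk₁⇒adj : ∀ {u v} → Walk H u v 1 → Adj H u v
  walk₁⇒adj (step a here) = a

  walk₂⇒middle : ∀ {u v} → Walk H u v 2 → ∃ λ w → Adj H u w × Adj H w v
  walk₂⇒middle (step a (step b here)) = _ , a , b

  _++ʷ_ : ∀ {u w v j k} → Walk H u w j → Walk H w v k → Walk H u v (j + k)
  here ++ʷ w′ = w′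
  step a w ++ʷ w′ = step a (w ++ʷ w′)

  dist-unique : ∀ {u v a b} → Dist H u v a → Dist H u v b → a ≡ b
  dist-unique (wa , ma) (wb , mb) = ≤-antisym (ma _ wb) (mb _ wa)

  dist-0 : ∀ {u} → Dist H u u 0
  dist-0 = here , λ _ _ → z≤n

  dist-1 : ∀ {u v} → u ≢ v → Adj H u v → Dist H u v 1
  dist-1 u≢v a = step a here , minimal
    where
    minimal : ∀ m → Walk H _ _ m → 1 ≤ m
    minimal zero w = contradiction (walk₀⇒≡ w) u≢v
    minimal (suc m) w = s≤s z≤n

  dist-2 : ∀ {u v w} → u ≢ v → ¬ Adj H u v → Adj H u w → Adj H w v → Dist H u v 2
  dist-2 u≢v ¬a a b = step a (step b here) , minimal
    where
    minimal : ∀ m → Walk H _ _ m → 2 ≤ m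
    minimal zero w = contradiction (walk₀⇒≡ w) u≢v
    minimal (suc zero) w = contradiction (walk₁⇒adj w) ¬a
    minimal (suc (suc m)) w = s≤s (s≤s z≤n)

  module _ (vertices : List (V H)) (complete : ∀ x → x ∈ vertices)
           (_≟_ : ∀ (x y : V H) → Dec (x ≡ y)) (adj? : ∀ x y → Dec (Adj H x y)) where

    walk? : ∀ m u v → Dec (Walk H u v m)
    walk? zero u v with u ≟ v
    ... | yes refl = yes here
    ... | no u≢v = no λ w → u≢v (walk₀⇒≡ w)
    walk? (suc m) u v with any? (λ w → adj? u w ×-dec walk? m w v) vertices
    ... | yes found = yes (fromAny found)
      where
      fromAny : ∀ {xs} → Any (λ w → Adj H u w × Walk H w v m) xs → Walk H u v (suc m)
      fromAny (here (a , w)) = step a w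
      fromAny (there found) = fromAny found
    ... | no none = no λ { (step {w = w} a wk) → none (toAny (complete w) a wk) }
      where
      toAny : ∀ {w xs} → w ∈ xs → Adj H u w → Walk H w v m →
              Any (λ w → Adj H u w × Walk H w v m) xs
      toAny (here refl) a wk = here (a , wk)
      toAny (there p) a wk = there (toAny p a wk)

    dist-exists : ∀ {u v L} → Walk H u v L → ∃ (Dist H u v)
    dist-exists {u} {v} = minimum-exists (λ m → walk? m u v)

-- Isomorphism invariance of the metric dimension

record _≅_ (H H′ : SGraph) : Set where
  field
    to        : V H → V H′
    from      : V H′ → V H
    from∘to   : ∀ x → from (to x) ≡ x
    to∘from   : ∀ y → to (from y) ≡ y
    to-adj    : ∀ {u v} → Adj H u v → Adj H′ (to u) (to v)
    from-adj  : ∀ {u v} → Adj H′ u v → Adj H (from u) (from v)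

  from-injective : ∀ {x y} → from x ≡ from y → x ≡ y
  from-injective {x} {y} e = trans (sym (to∘from x)) (trans (cong to e) (to∘from y))

≅-sym : ∀ {H H′} → H ≅ H′ → H′ ≅ H
≅-sym I = record
  { to = from ; from = to ; from∘to = to∘from ; to∘from = from∘to ; to-adj = from-adj ; from-adj = to-adj }
  where open _≅_ I

module _ {H H′ : SGraph} (I : H ≅ H′) where
  open _≅_ I

  map-walk : ∀ {u v k} → Walk H′ u v k → Walk H (from u) (from v) k
  map-walk here = here
  map-walk (step a w) = step (from-adj a) (map-walk w)

  map-dist : ∀ {u v k} → Dist H′ u v k → Dist H (from u) (from v) k
  map-dist {u} {v} (w , minimal) =
    map-walk w ,
    λ m w′ → minimal m (subst₂ (λ x y → Walk H′ x y m) (to∘from u) (to∘from v) (map-walk′ w′))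
    where
    map-walk′ : ∀ {x y k} → Walk H x y k → Walk H′ (to x) (to y) k
    map-walk′ here = here
    map-walk′ (step a w) = step (to-adj a) (map-walk′ w)

  map-resolving : ∀ W → Resolving H′ W → Resolving H (map from W)
  map-resolving W R u v u≢v with R (to u) (to v) (u≢v ∘ _≅_.from-injective (≅-sym I))
  ... | x , x∈W , a , b , du , dv , a≢b =
    from x , ∈-map⁺ from x∈W , a , b ,
    subst (λ z → Dist H z (from x) a) (from∘to u) (map-dist du) ,
    subst (λ z → Dist H z (from x) b) (from∘to v) (map-dist dv) , a≢b

metricDim-≅ : ∀ {H H′} → H ≅ H′ → ∀ k → MetricDim H′ k → MetricDim H k
metricDim-≅ I k ((W , W! , R , |W|≡k) , lower) =
  (map from W , Unique.map⁺ from-injective W! , map-resolving I W R , trans (length-map from W) |W|≡k) ,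
  λ W′ W′! R′ → subst (k ≤_) (length-map to W′)
    (lower (map to W′) (Unique.map⁺ (_≅_.from-injective (≅-sym I)) W′!)
                       (map-resolving (≅-sym I) W′ R′))
  where open _≅_ I

-- Arithmetic and finite encodings

ceil3+[n*2/3]≡n : ∀ n → ceil3 n + n * 2 / 3 ≡ n
ceil3+[n*2/3]≡n 0 = refl
ceil3+[n*2/3]≡n 1 = refl
ceil3+[n*2/3]≡n 2 = refl
ceil3+[n*2/3]≡n (suc (suc (suc n))) = begin
    (3 + n + 2) / 3 + (6 + n * 2) / 3
  ≡⟨ cong₂ _+_ (m/n≡1+[m∸n]/n {3 + n + 2} (s≤s (s≤s (s≤s z≤n))))
               (m/n≡1+[m∸n]/n {6 + n * 2} (s≤s (s≤s (s≤s z≤n)))) ⟩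
    suc (ceil3 n) + suc ((3 + n * 2) / 3)
  ≡⟨ cong (λ t → suc (ceil3 n) + suc t) (m/n≡1+[m∸n]/n {3 + n * 2} (s≤s (s≤s (s≤s z≤n)))) ⟩
    suc (ceil3 n) + suc (suc (n * 2 / 3))
  ≡⟨ cong suc (trans (+-suc (ceil3 n) _) (cong suc (+-suc (ceil3 n) _))) ⟩
    3 + (ceil3 n + n * 2 / 3)
  ≡⟨ cong (3 +_) (ceil3+[n*2/3]≡n n) ⟩
    3 + n ∎
  where open ≡-Reasoning

n∸ceil3≡n*2/3 : ∀ n → n ∸ ceil3 n ≡ n * 2 / 3
n∸ceil3≡n*2/3 n = begin
  n ∸ ceil3 n                           ≡⟨ cong (_∸ ceil3 n) (sym (ceil3+[n*2/3]≡n n)) ⟩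
  ceil3 n + n * 2 / 3 ∸ ceil3 n         ≡⟨ m+n∸m≡n (ceil3 n) _ ⟩
  n * 2 / 3                             ∎
  where open ≡-Reasoning

[m*3+2]/3≡m : ∀ m → (m * 3 + 2) / 3 ≡ m
[m*3+2]/3≡m m = trans (+-distrib-/-∣ˡ 2 (divides m refl)) (trans (+-identityʳ _) (m*n/n≡m m 3))

toFin-×⊎ : ∀ {m k l} → (Fin m × Fin k) ⊎ Fin l → Fin (m * k + l)
toFin-×⊎ {m} {k} {l} = join (m * k) l ∘ Sum.map₁ (uncurry combine)

toFin-×⊎-injective : ∀ {m k l} (σ τ : (Fin m × Fin k) ⊎ Fin l) →
                     toFin-×⊎ σ ≡ toFin-×⊎ τ → σ ≡ τ
toFin-×⊎-injective {m} {k} {l} σ τ e = map₁-injective σ τ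
  (trans (sym (splitAt-join (m * k) l _)) (trans (cong (splitAt (m * k)) e) (splitAt-join (m * k) l _)))
  where
  map₁-injective : ∀ σ τ → Sum.map₁ (uncurry combine) σ ≡ Sum.map₁ (uncurry combine) τ → σ ≡ τ
  map₁-injective (inj₁ (i , j)) (inj₁ (i′ , j′)) e =
    cong inj₁ (trans (sym (remQuot-combine i j))
                     (trans (cong (remQuot k) (inj₁-injective e)) (remQuot-combine i′ j′)))
  map₁-injective (inj₂ x) (inj₂ y) refl = refl

-- Steps along the cycle

module Cycle (n : ℕ) {{_ : NonZero n}} where

  infix 4 _⟶[_]_

  record _⟶[_]_ (p : Fin n) (k : ℕ) (q : Fin n) : Set where
    constructor steps
    field toℕ-≡ : toℕ q ≡ (toℕ p + k) % n
  open _⟶[_]_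

  shift : ℕ → Fin n → Fin n
  shift k p = fromℕ< (m%n<n (toℕ p + k) n)

  next prev : Fin n → Fin n
  next = shift 1
  prev = shift (n ∸ 1)

  _⟶[_]?_ : ∀ p k q → Dec (p ⟶[ k ] q)
  p ⟶[ k ]? q with toℕ q ≟ (toℕ p + k) % n
  ... | yes e = yes (steps e)
  ... | no ne = no λ s → ne (toℕ-≡ s)

  ⟶-shift : ∀ k p → p ⟶[ k ] shift k p
  ⟶-shift k p = steps (toℕ-fromℕ< _)

  ⟶-functional : ∀ {p q q′ k} → p ⟶[ k ] q → p ⟶[ k ] q′ → q ≡ q′
  ⟶-functional (steps e) (steps e′) = toℕ-injective (trans e (sym e′))

  ⟶-refl : ∀ p → p ⟶[ 0 ] p
  ⟶-refl p = steps (sym (trans (cong (_% n) (+-identityʳ (toℕ p))) (m<n⇒m%n≡m (toℕ<n p))))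

  ⟶₀⇒≡ : ∀ {p q} → p ⟶[ 0 ] q → p ≡ q
  ⟶₀⇒≡ {p} s = ⟶-functional (⟶-refl p) s

  private
    [m%n+k]%n≡[m+k]%n : ∀ m k → (m % n + k) % n ≡ (m + k) % n
    [m%n+k]%n≡[m+k]%n m k = begin
      (m % n + k) % n             ≡⟨ %-distribˡ-+ (m % n) k n ⟩
      (m % n % n + k % n) % n     ≡⟨ cong (λ z → (z + k % n) % n) (m%n%n≡m%n m n) ⟩
      (m % n + k % n) % n         ≡⟨ %-distribˡ-+ m k n ⟨
      (m + k) % n                 ∎
      where open ≡-Reasoning

  ⟶-trans : ∀ {p q r j k} → p ⟶[ j ] q → q ⟶[ k ] r → p ⟶[ j + k ] r
  ⟶-trans {p} {q} {r} {j} {k} (steps e₁) (steps e₂) = steps (begin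
    toℕ r                         ≡⟨ e₂ ⟩
    (toℕ q + k) % n               ≡⟨ cong (λ z → (z + k) % n) e₁ ⟩
    ((toℕ p + j) % n + k) % n     ≡⟨ [m%n+k]%n≡[m+k]%n (toℕ p + j) k ⟩
    (toℕ p + j + k) % n           ≡⟨ cong (_% n) (+-assoc (toℕ p) j k) ⟩
    (toℕ p + (j + k)) % n         ∎)
    where open ≡-Reasoning

  ⟶-reverse : ∀ {p q j} → p ⟶[ j ] q → j ≤ n → q ⟶[ n ∸ j ] p
  ⟶-reverse {p} {q} {j} (steps e) j≤n = steps (sym (begin
    (toℕ q + (n ∸ j)) % n           ≡⟨ cong (λ z → (z + (n ∸ j)) % n) e ⟩
    ((toℕ p + j) % n + (n ∸ j)) % n ≡⟨ [m%n+k]%n≡[m+k]%n (toℕ p + j) (n ∸ j) ⟩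
    (toℕ p + j + (n ∸ j)) % n       ≡⟨ cong (_% n) (+-assoc (toℕ p) j (n ∸ j)) ⟩
    (toℕ p + (j + (n ∸ j))) % n     ≡⟨ cong (λ z → (toℕ p + z) % n) (m+[n∸m]≡n j≤n) ⟩
    (toℕ p + n) % n                 ≡⟨ [m+n]%n≡m%n (toℕ p) n ⟩
    toℕ p % n                       ≡⟨ m<n⇒m%n≡m (toℕ<n p) ⟩
    toℕ p                           ∎))
    where open ≡-Reasoning

  ⟶-shift⁻ : ∀ k p → k ≤ n → shift (n ∸ k) p ⟶[ k ] p
  ⟶-shift⁻ k p k≤n =
    subst (λ j → shift (n ∸ k) p ⟶[ j ] p) (m∸[m∸n]≡n k≤n)
          (⟶-reverse (⟶-shift (n ∸ k) p) (m∸n≤m n k))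

  ⟶-next : ∀ p → p ⟶[ 1 ] next p
  ⟶-next = ⟶-shift 1

  ⟶-prev : ∀ p → prev p ⟶[ 1 ] p
  ⟶-prev p = ⟶-shift⁻ 1 p (>-nonZero⁻¹ n)

  ⟶-unfold : ∀ {p q k} → p ⟶[ k ] q → k < n → toℕ p + k ≡ toℕ q ⊎ toℕ p + k ≡ toℕ q + n
  ⟶-unfold {p} {q} {k} (steps e) k<n with toℕ p + k <? n
  ... | yes lt = inj₁ (sym (trans e (m<n⇒m%n≡m lt)))
  ... | no nlt = inj₂ (begin
    toℕ p + k             ≡⟨ m∸n+n≡m n≤p+k ⟨
    toℕ p + k ∸ n + n     ≡⟨ cong (_+ n) (sym (trans e (wrap (toℕ p + k) n≤p+k p+k∸n<n))) ⟩
    toℕ q + n             ∎)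
    where
    open ≡-Reasoning
    wrap : ∀ s → n ≤ s → s ∸ n < n → s % n ≡ s ∸ n
    wrap s n≤s s∸n<n = begin
      s % n             ≡⟨ cong (_% n) (m∸n+n≡m n≤s) ⟨
      (s ∸ n + n) % n   ≡⟨ [m+n]%n≡m%n (s ∸ n) n ⟩
      (s ∸ n) % n       ≡⟨ m<n⇒m%n≡m s∸n<n ⟩
      s ∸ n             ∎
    n≤p+k : n ≤ toℕ p + k
    n≤p+k = ≮⇒≥ nlt
    p+k∸n<n : toℕ p + k ∸ n < n
    p+k∸n<n = +-cancelʳ-< _ _ n (subst (_< n + n) (sym (m∸n+n≡m n≤p+k)) (+-mono-< (toℕ<n p) k<n))

  ⟶-irrefl : ∀ {p k} → p ⟶[ k ] p → 0 < k → k < n → ⊥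
  ⟶-irrefl {p} {k} s 0<k k<n with ⟶-unfold s k<n
  ... | inj₁ e = <-irrefl (sym e) (m<m+n (toℕ p) 0<k)
  ... | inj₂ e = <-irrefl (+-cancelˡ-≡ (toℕ p) k n e) k<n

  private
    ⟶-steps-≮ : ∀ {p q j k} → p ⟶[ j ] q → p ⟶[ k ] q → j < k → k < n → ⊥
    ⟶-steps-≮ {j = j} {k} s s′ j<k k<n = ⟶-irrefl (⟶-trans s (⟶-reverse s′ (<⇒≤ k<n)))
      (≤-trans (m<n⇒0<n∸m k<n) (m≤n+m (n ∸ k) j))
      (subst (j + (n ∸ k) <_) (m+[n∸m]≡n (<⇒≤ k<n)) (+-monoˡ-< (n ∸ k) j<k))

  ⟶-steps-unique : ∀ {p q j k} → p ⟶[ j ] q → p ⟶[ k ] q → j < n → k < n → j ≡ k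
  ⟶-steps-unique {j = j} {k} s s′ j<n k<n with <-cmp j k
  ... | tri< j<k _ _ = ⊥-elim (⟶-steps-≮ s s′ j<k k<n)
  ... | tri≈ _ j≡k _ = j≡k
  ... | tri> _ _ k<j = ⊥-elim (⟶-steps-≮ s′ s k<j j<n)

  ⟶-source-unique : ∀ {p q r} → p ⟶[ 1 ] r → q ⟶[ 1 ] r → p ≡ q
  ⟶-source-unique s s′ = ⟶-functional (⟶-reverse s 1≤n) (⟶-reverse s′ 1≤n)
    where 1≤n = >-nonZero⁻¹ n

-- The line graph of the wheel

module WheelLineGraph (n : ℕ) (6≤n : 6 ≤ n) where

  instance
    n≢0 : NonZero n
    n≢0 = >-nonZero (≤-trans (s≤s z≤n) 6≤n)

  open Cycle n

  steps<n : ∀ k → True (k <? 6) → k < n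
  steps<n k k<6 = <-≤-trans (toWitness k<6) 6≤n

  -- For literal offsets the implicit arguments are discharged by evaluation.
  steps-clash : ∀ {p q j k} → p ⟶[ j ] q → p ⟶[ k ] q →
                {True (j <? 6)} → {True (k <? 6)} → {False (j ≟ k)} → ⊥
  steps-clash {j = j} {k} s s′ {j<6} {k<6} {j≢k} =
    toWitnessFalse j≢k (⟶-steps-unique s s′ (steps<n j j<6) (steps<n k k<6))

  -- spoke a is the wheel edge from the hub to cycle vertex a, rim p the edge from p to p + 1.
  data WheelEdge : Set where
    spoke : Fin n → WheelEdge
    rim   : Fin n → WheelEdge

  Endpoint : Fin n → Fin n → Set
  Endpoint c p = p ⟶[ 0 ] c ⊎ p ⟶[ 1 ] c

  endpoint? : ∀ c p → Dec (Endpoint c p)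
  endpoint? c p = (p ⟶[ 0 ]? c) ⊎-dec (p ⟶[ 1 ]? c)

  Meet : WheelEdge → WheelEdge → Set
  Meet (spoke a) (spoke b) = a ≢ b
  Meet (spoke a) (rim p)   = Endpoint a p
  Meet (rim p)   (spoke a) = Endpoint a p
  Meet (rim p)   (rim q)   = p ⟶[ 1 ] q ⊎ q ⟶[ 1 ] p

  LineWheel : SGraph
  LineWheel = record { V = WheelEdge ; Adj = Meet }

  spoke-injective : ∀ {a b} → spoke a ≡ spoke b → a ≡ b
  spoke-injective refl = refl

  rim-injective : ∀ {p q} → rim p ≡ rim q → p ≡ q
  rim-injective refl = refl

  _≟ᵉ_ : ∀ (x y : WheelEdge) → Dec (x ≡ y)
  spoke a ≟ᵉ spoke b = map′ (cong spoke) spoke-injective (a ≟ᶠ b)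
  spoke a ≟ᵉ rim q   = no λ ()
  rim p   ≟ᵉ spoke b = no λ ()
  rim p   ≟ᵉ rim q   = map′ (cong rim) rim-injective (p ≟ᶠ q)

  meet? : ∀ x y → Dec (Meet x y)
  meet? (spoke a) (spoke b) = ¬? (a ≟ᶠ b)
  meet? (spoke a) (rim p)   = endpoint? a p
  meet? (rim p)   (spoke a) = endpoint? a p
  meet? (rim p)   (rim q)   = (p ⟶[ 1 ]? q) ⊎-dec (q ⟶[ 1 ]? p)

  meet-sym : ∀ {x y} → Meet x y → Meet y x
  meet-sym {spoke a} {spoke b} a≢b = λ b≡a → a≢b (sym b≡a)
  meet-sym {spoke a} {rim p}   e = e
  meet-sym {rim p}   {spoke a} e = e
  meet-sym {rim p}   {rim q}   s = swap s

  meet⇒≢ : ∀ {x y} → Meet x y → x ≢ y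
  meet⇒≢ {spoke a} a≢a refl = a≢a refl
  meet⇒≢ {rim p} (inj₁ s) refl = steps-clash s (⟶-refl p)
  meet⇒≢ {rim p} (inj₂ s) refl = steps-clash s (⟶-refl p)

  endpoint-self : ∀ p → Endpoint p p
  endpoint-self p = inj₁ (⟶-refl p)

  ¬endpoint⇒spokes-meet : ∀ {c p} → ¬ Endpoint c p → Meet (spoke c) (spoke p)
  ¬endpoint⇒spokes-meet {p = p} ¬e refl = ¬e (endpoint-self p)

  edges : List WheelEdge
  edges = map spoke (allFin n) ++ map rim (allFin n)

  ∈-edges : ∀ x → x ∈ edges
  ∈-edges (spoke a) = ∈-++⁺ˡ (∈-map⁺ spoke (∈-allFin a))
  ∈-edges (rim p)   = ∈-++⁺ʳ (map spoke (allFin n)) (∈-map⁺ rim (∈-allFin p))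

  walk-exists : ∀ u v → ∃ (Walk LineWheel u v)
  walk-exists (spoke a) v = from-spoke a v
    where
    between-spokes : ∀ a b → ∃ (Walk LineWheel (spoke a) (spoke b))
    between-spokes a b with a ≟ᶠ b
    ... | yes refl = 0 , here
    ... | no a≢b = 1 , step a≢b here
    from-spoke : ∀ a v → ∃ (Walk LineWheel (spoke a) v)
    from-spoke a (spoke b) = between-spokes a b
    from-spoke a (rim q) with between-spokes a q
    ... | k , w = k + 1 , w ++ʷ step (endpoint-self q) here
  walk-exists (rim p) v with walk-exists (spoke p) v
  ... | k , w = suc k , step (endpoint-self p) w

  dist : ∀ u v → ∃ (Dist LineWheel u v)
  dist u v = dist-exists edges ∈-edges _≟ᵉ_ meet? (proj₂ (walk-exists u v))

  Succ : Fin n → Fin n → Set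
  Succ i j = suc (toℕ i) ≡ toℕ j ⊎ (suc (toℕ i) ≡ n × toℕ j ≡ 0)

  ⟶₁⇒succ : ∀ {i j} → i ⟶[ 1 ] j → Succ i j
  ⟶₁⇒succ {i} {j} s with ⟶-unfold s (steps<n 1 _)
  ... | inj₁ e = inj₁ (trans (+-comm 1 (toℕ i)) e)
  ... | inj₂ e = inj₂ (≤-antisym (toℕ<n i) n≤1+i , j≡0)
    where
    e′ : suc (toℕ i) ≡ toℕ j + n
    e′ = trans (+-comm 1 (toℕ i)) e
    j≡0 : toℕ j ≡ 0
    j≡0 = n≤0⇒n≡0 (+-cancelʳ-≤ n (toℕ j) 0 (subst (_≤ n) e′ (toℕ<n i)))
    n≤1+i : n ≤ suc (toℕ i)
    n≤1+i = subst (n ≤_) (sym e′) (m≤n+m n (toℕ j))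

  succ⇒⟶₁ : ∀ {i j} → Succ i j → i ⟶[ 1 ] j
  succ⇒⟶₁ {i} {j} (inj₁ e) =
    steps (sym (trans (cong (_% n) (trans (+-comm (toℕ i) 1) e)) (m<n⇒m%n≡m (toℕ<n j))))
  succ⇒⟶₁ {i} {j} (inj₂ (e , j≡0)) =
    steps (trans j≡0 (sym (trans (cong (_% n) (trans (+-comm (toℕ i) 1) e)) (n%n≡0 n))))

  cycAdj⇒⟶₁ : ∀ i j → T (cycAdj n i j) → i ⟶[ 1 ] j ⊎ j ⟶[ 1 ] i
  cycAdj⇒⟶₁ i j t with Equivalence.to (T-∨ {(suc (toℕ i) ≡ᵇ toℕ j) ∨ (suc (toℕ j) ≡ᵇ toℕ i)}) t
  ... | inj₁ t₁ with Equivalence.to (T-∨ {suc (toℕ i) ≡ᵇ toℕ j}) t₁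
  ...   | inj₁ a = inj₁ (succ⇒⟶₁ (inj₁ (≡ᵇ⇒≡ _ _ a)))
  ...   | inj₂ b = inj₂ (succ⇒⟶₁ (inj₁ (≡ᵇ⇒≡ _ _ b)))
  cycAdj⇒⟶₁ i j t | inj₂ t₂ with Equivalence.to (T-∨ {(toℕ i ≡ᵇ 0) ∧ (suc (toℕ j) ≡ᵇ n)}) t₂
  ...   | inj₁ c with Equivalence.to (T-∧ {toℕ i ≡ᵇ 0}) c
  ...     | i≡0 , 1+j≡n = inj₂ (succ⇒⟶₁ (inj₂ (≡ᵇ⇒≡ _ _ 1+j≡n , ≡ᵇ⇒≡ _ _ i≡0)))
  cycAdj⇒⟶₁ i j t | inj₂ t₂ | inj₂ d with Equivalence.to (T-∧ {toℕ j ≡ᵇ 0}) d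
  ...     | j≡0 , 1+i≡n = inj₁ (succ⇒⟶₁ (inj₂ (≡ᵇ⇒≡ _ _ 1+i≡n , ≡ᵇ⇒≡ _ _ j≡0)))

  ⟶₁⇒cycAdj : ∀ {i j} → i ⟶[ 1 ] j → T (cycAdj n i j) × T (cycAdj n j i)
  ⟶₁⇒cycAdj {i} {j} s with ⟶₁⇒succ s
  ... | inj₁ e =
    Equivalence.from T-∨ (inj₁ (Equivalence.from T-∨ (inj₁ (≡⇒≡ᵇ _ _ e)))) ,
    Equivalence.from T-∨ (inj₁ (Equivalence.from (T-∨ {suc (toℕ j) ≡ᵇ toℕ i}) (inj₂ (≡⇒≡ᵇ _ _ e))))
  ... | inj₂ (e , j≡0) =
    Equivalence.from (T-∨ {(suc (toℕ i) ≡ᵇ toℕ j) ∨ (suc (toℕ j) ≡ᵇ toℕ i)})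
      (inj₂ (Equivalence.from (T-∨ {(toℕ i ≡ᵇ 0) ∧ (suc (toℕ j) ≡ᵇ n)})
        (inj₂ (Equivalence.from T-∧ (≡⇒≡ᵇ _ _ j≡0 , ≡⇒≡ᵇ _ _ e))))) ,
    Equivalence.from (T-∨ {(suc (toℕ j) ≡ᵇ toℕ i) ∨ (suc (toℕ i) ≡ᵇ toℕ j)})
      (inj₂ (Equivalence.from T-∨ (inj₁ (Equivalence.from T-∧ (≡⇒≡ᵇ _ _ j≡0 , ≡⇒≡ᵇ _ _ e)))))

  WEdge : Set
  WEdge = Edge (Wheel n)

  wedge-≡ : (e e′ : WEdge) → proj₁ e ≡ proj₁ e′ → e ≡ e′
  wedge-≡ ((u , v) , u<v , t) ((.u , .v) , u<v′ , t′) refl =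
    cong₂ (λ a b → ((u , v) , a , b)) (≤-irrelevant u<v u<v′) (T-irrelevant t t′)

  rimEdge : (p q : Fin n) → p ⟶[ 1 ] q → WEdge
  rimEdge p q s with toℕ p <? toℕ q
  ... | yes p<q = (fsuc p , fsuc q) , s≤s p<q , proj₁ (⟶₁⇒cycAdj s)
  ... | no p≮q = (fsuc q , fsuc p) , s≤s (≤∧≢⇒< (≮⇒≥ p≮q) q≢p) , proj₂ (⟶₁⇒cycAdj s)
    where
    q≢p : toℕ q ≢ toℕ p
    q≢p e = steps-clash (subst (p ⟶[ 1 ]_) (toℕ-injective e) s) (⟶-refl p)

  rimEdge-ends : ∀ p q (s : p ⟶[ 1 ] q) →
    (proj₁ (rimEdge p q s) ≡ (fsuc p , fsuc q) × toℕ p < toℕ q) ⊎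
    (proj₁ (rimEdge p q s) ≡ (fsuc q , fsuc p) × ¬ toℕ p < toℕ q)
  rimEdge-ends p q s with toℕ p <? toℕ q
  ... | yes p<q = inj₁ (refl , p<q)
  ... | no p≮q = inj₂ (refl , p≮q)

  toWEdge : WheelEdge → WEdge
  toWEdge (spoke a) = (fzero , fsuc a) , s≤s z≤n , _
  toWEdge (rim p) = rimEdge p (next p) (⟶-next p)

  fromWEdge : WEdge → WheelEdge
  fromWEdge ((fzero , fzero) , () , _)
  fromWEdge ((fzero , fsuc a) , _) = spoke a
  fromWEdge ((fsuc i , fzero) , () , _)
  fromWEdge ((fsuc i , fsuc j) , _) with i ⟶[ 1 ]? j
  ... | yes _ = rim i
  ... | no _ = rim j

  fromWEdge∘toWEdge : ∀ x → fromWEdge (toWEdge x) ≡ x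
  fromWEdge∘toWEdge (spoke a) = refl
  fromWEdge∘toWEdge (rim p) with toℕ p <? toℕ (next p)
  ... | yes _ with p ⟶[ 1 ]? next p
  ...   | yes _ = refl
  ...   | no ¬s = contradiction (⟶-next p) ¬s
  fromWEdge∘toWEdge (rim p) | no _ with next p ⟶[ 1 ]? p
  ...   | yes s = ⊥-elim (steps-clash (⟶-trans (⟶-next p) s) (⟶-refl p))
  ...   | no _ = refl

  toWEdge∘fromWEdge : ∀ e → toWEdge (fromWEdge e) ≡ e
  toWEdge∘fromWEdge ((fzero , fzero) , () , _)
  toWEdge∘fromWEdge ((fzero , fsuc a) , _) = wedge-≡ _ _ refl
  toWEdge∘fromWEdge ((fsuc i , fzero) , () , _)
  toWEdge∘fromWEdge ((fsuc i , fsuc j) , s≤s i<j , t) with i ⟶[ 1 ]? j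
  ... | yes s with rimEdge-ends i (next i) (⟶-next i)
  ...   | inj₁ (e , _) = wedge-≡ _ _ (trans e (cong (λ z → fsuc i , fsuc z) (⟶-functional (⟶-next i) s)))
  ...   | inj₂ (_ , i≮) =
    contradiction (subst (λ z → toℕ i < toℕ z) (sym (⟶-functional (⟶-next i) s)) i<j) i≮
  toWEdge∘fromWEdge ((fsuc i , fsuc j) , s≤s i<j , t) | no ¬s with cycAdj⇒⟶₁ i j t
  ... | inj₁ s = contradiction s ¬s
  ... | inj₂ s with rimEdge-ends j (next j) (⟶-next j)
  ...   | inj₁ (_ , j<) =
    ⊥-elim (<-asym i<j (subst (λ z → toℕ j < toℕ z) (⟶-functional (⟶-next j) s) j<))
  ...   | inj₂ (e , _) = wedge-≡ _ _ (trans e (cong (λ z → fsuc z , fsuc j) (⟶-functional (⟶-next j) s)))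

  Incident : Fin (suc n) → WheelEdge → Set
  Incident c (spoke a) = c ≡ fzero ⊎ c ≡ fsuc a
  Incident c (rim p) = Σ (Fin n) λ d → c ≡ fsuc d × Endpoint d p

  CommonEnd : WheelEdge → WheelEdge → Set
  CommonEnd x y = ∃ λ c → Incident c x × Incident c y

  end₁ end₂ : WheelEdge → Fin (suc n)
  end₁ x = proj₁ (proj₁ (toWEdge x))
  end₂ x = proj₂ (proj₁ (toWEdge x))

  incident-ends : ∀ x → Incident (end₁ x) x × Incident (end₂ x) x ×
                        (∀ c → Incident c x → c ≡ end₁ x ⊎ c ≡ end₂ x)
  incident-ends (spoke a) = inj₁ refl , inj₂ refl , λ _ i → i
  incident-ends (rim p) with rimEdge-ends p (next p) (⟶-next p)
  ... | inj₁ (e , _) =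
    subst (λ z → Incident z (rim p)) (sym (cong proj₁ e)) (p , refl , endpoint-self p) ,
    subst (λ z → Incident z (rim p)) (sym (cong proj₂ e)) (next p , refl , inj₂ (⟶-next p)) ,
    λ { c (d , refl , inj₁ s) → inj₁ (trans (cong fsuc (sym (⟶₀⇒≡ s))) (sym (cong proj₁ e)))
      ; c (d , refl , inj₂ s) → inj₂ (trans (cong fsuc (⟶-functional s (⟶-next p))) (sym (cong proj₂ e))) }
  ... | inj₂ (e , _) =
    subst (λ z → Incident z (rim p)) (sym (cong proj₁ e)) (next p , refl , inj₂ (⟶-next p)) ,
    subst (λ z → Incident z (rim p)) (sym (cong proj₂ e)) (p , refl , endpoint-self p) ,
    λ { c (d , refl , inj₁ s) → inj₂ (trans (cong fsuc (sym (⟶₀⇒≡ s))) (sym (cong proj₂ e)))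
      ; c (d , refl , inj₂ s) → inj₁ (trans (cong fsuc (⟶-functional s (⟶-next p))) (sym (cong proj₁ e))) }

  ShareEnd : WheelEdge → WheelEdge → Set
  ShareEnd x y = end₁ x ≡ end₁ y ⊎ end₁ x ≡ end₂ y ⊎ end₂ x ≡ end₁ y ⊎ end₂ x ≡ end₂ y

  shareEnd⇒commonEnd : ∀ x y → ShareEnd x y → CommonEnd x y
  shareEnd⇒commonEnd x y sh with incident-ends x | incident-ends y
  ... | i₁ , i₂ , _ | j₁ , j₂ , _ with sh
  ... | inj₁ e                = end₁ x , i₁ , subst (λ z → Incident z y) (sym e) j₁
  ... | inj₂ (inj₁ e)         = end₁ x , i₁ , subst (λ z → Incident z y) (sym e) j₂
  ... | inj₂ (inj₂ (inj₁ e))  = end₂ x , i₂ , subst (λ z → Incident z y) (sym e) j₁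
  ... | inj₂ (inj₂ (inj₂ e))  = end₂ x , i₂ , subst (λ z → Incident z y) (sym e) j₂

  commonEnd⇒shareEnd : ∀ x y → CommonEnd x y → ShareEnd x y
  commonEnd⇒shareEnd x y (c , ix , iy)
    with proj₂ (proj₂ (incident-ends x)) c ix | proj₂ (proj₂ (incident-ends y)) c iy
  ... | inj₁ a | inj₁ b = inj₁ (trans (sym a) b)
  ... | inj₁ a | inj₂ b = inj₂ (inj₁ (trans (sym a) b))
  ... | inj₂ a | inj₁ b = inj₂ (inj₂ (inj₁ (trans (sym a) b)))
  ... | inj₂ a | inj₂ b = inj₂ (inj₂ (inj₂ (trans (sym a) b)))

  meet⇒commonEnd : ∀ x y → Meet x y → CommonEnd x y
  meet⇒commonEnd (spoke a) (spoke b) _ = fzero , inj₁ refl , inj₁ refl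
  meet⇒commonEnd (spoke a) (rim p) e = fsuc a , inj₂ refl , (a , refl , e)
  meet⇒commonEnd (rim p) (spoke a) e = fsuc a , (a , refl , e) , inj₂ refl
  meet⇒commonEnd (rim p) (rim q) (inj₁ s) = fsuc q , (q , refl , inj₂ s) , (q , refl , endpoint-self q)
  meet⇒commonEnd (rim p) (rim q) (inj₂ s) = fsuc p , (p , refl , endpoint-self p) , (p , refl , inj₂ s)

  commonEnd⇒meet : ∀ x y → x ≢ y → CommonEnd x y → Meet x y
  commonEnd⇒meet (spoke a) (spoke b) x≢y _ = λ a≡b → x≢y (cong spoke a≡b)
  commonEnd⇒meet (spoke a) (rim p) _ (_ , inj₁ refl , (d , () , _))
  commonEnd⇒meet (spoke a) (rim p) _ (_ , inj₂ refl , (d , refl , e)) = e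
  commonEnd⇒meet (rim p) (spoke a) _ (_ , (d , () , _) , inj₁ refl)
  commonEnd⇒meet (rim p) (spoke a) _ (_ , (d , refl , e) , inj₂ refl) = e
  commonEnd⇒meet (rim p) (rim q) x≢y (_ , (d , refl , e) , (.d , refl , e′)) with e | e′
  ... | inj₁ s | inj₁ s′ = contradiction (cong rim (trans (⟶₀⇒≡ s) (sym (⟶₀⇒≡ s′)))) x≢y
  ... | inj₁ s | inj₂ s′ = inj₂ (subst (q ⟶[ 1 ]_) (sym (⟶₀⇒≡ s)) s′)
  ... | inj₂ s | inj₁ s′ = inj₁ (subst (p ⟶[ 1 ]_) (sym (⟶₀⇒≡ s′)) s)
  ... | inj₂ s | inj₂ s′ = contradiction (cong rim (⟶-source-unique s s′)) x≢y

  lineGraph≅LineWheel : LineGraph (Wheel n) ≅ LineWheel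
  lineGraph≅LineWheel = record
    { to = fromWEdge ; from = toWEdge
    ; from∘to = toWEdge∘fromWEdge ; to∘from = fromWEdge∘toWEdge
    ; to-adj = λ {e} {e′} a → meet-of-adj {fromWEdge e} {fromWEdge e′}
        (subst₂ (Adj (LineGraph (Wheel n))) (sym (toWEdge∘fromWEdge e)) (sym (toWEdge∘fromWEdge e′)) a)
    ; from-adj = adj-of-meet }
    where
    adj-of-meet : ∀ {x y} → Meet x y → Adj (LineGraph (Wheel n)) (toWEdge x) (toWEdge y)
    adj-of-meet {x} {y} m =
      (λ e → meet⇒≢ m (trans (sym (fromWEdge∘toWEdge x))
                            (trans (cong fromWEdge (wedge-≡ _ _ e)) (fromWEdge∘toWEdge y)))) ,
      commonEnd⇒shareEnd x y (meet⇒commonEnd x y m)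
    meet-of-adj : ∀ {x y} → Adj (LineGraph (Wheel n)) (toWEdge x) (toWEdge y) → Meet x y
    meet-of-adj {x} {y} (ne , sh) =
      commonEnd⇒meet x y (λ e → ne (cong (λ z → proj₁ (toWEdge z)) e)) (shareEnd⇒commonEnd x y sh)

  -- Upper bound

  Far : WheelEdge → WheelEdge → Set
  Far u x = u ≢ x × ¬ Meet u x × (∀ w → Meet u w → Meet w x → ⊥)

  far-sym : ∀ {u x} → Far u x → Far x u
  far-sym (u≢x , ¬m , ¬w) =
    (λ e → u≢x (sym e)) , (λ m → ¬m (meet-sym m)) , λ w a b → ¬w w (meet-sym b) (meet-sym a)

  ⟶₃⇒far : ∀ {p q} → p ⟶[ 3 ] q → Far (rim p) (rim q)
  ⟶₃⇒far {p} s = (λ { refl → steps-clash s (⟶-refl p) }) , no-meet , no-common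
    where
    no-meet : ¬ Meet (rim p) (rim _)
    no-meet (inj₁ s′) = steps-clash s s′
    no-meet (inj₂ s′) = steps-clash (⟶-trans s s′) (⟶-refl p)
    no-common : ∀ w → Meet (rim p) w → Meet w (rim _) → ⊥
    no-common (spoke c) (inj₁ a) (inj₁ b) = steps-clash (⟶-trans s b) a
    no-common (spoke c) (inj₁ a) (inj₂ b) = steps-clash (⟶-trans s b) a
    no-common (spoke c) (inj₂ a) (inj₁ b) = steps-clash (⟶-trans s b) a
    no-common (spoke c) (inj₂ a) (inj₂ b) = steps-clash (⟶-trans s b) a
    no-common (rim r) (inj₁ a) (inj₁ b) = steps-clash (⟶-trans a b) s
    no-common (rim r) (inj₁ a) (inj₂ b) = steps-clash (⟶-trans s b) a
    no-common (rim r) (inj₂ a) (inj₁ b) = steps-clash (⟶-trans a s) b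
    no-common (rim r) (inj₂ a) (inj₂ b) = steps-clash (⟶-trans b (⟶-trans a s)) (⟶-refl _)

  spoke-near-rim : ∀ c p → ∃ λ m → m ≤ 2 × Walk LineWheel (spoke c) (rim p) m
  spoke-near-rim c p with endpoint? c p
  ... | yes e = 1 , s≤s z≤n , step e here
  ... | no ¬e = 2 , ≤-refl , step (¬endpoint⇒spokes-meet ¬e) (step (endpoint-self p) here)

  module RimLandmarks
    (Gap : Fin n → Set) (gap? : ∀ p → Dec (Gap p))
    (gaps-not-2-apart : ∀ {x y} → x ⟶[ 2 ] y → Gap x → Gap y → ⊥)
    (gap-pairs-unique : ∀ {x y x′ y′} → x ⟶[ 1 ] y → Gap x → Gap y →
                        x′ ⟶[ 1 ] y′ → Gap x′ → Gap y′ → y ≡ y′)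
    (W : List WheelEdge) (rim∈W : ∀ p → ¬ Gap p → rim p ∈ W)
    where

    Separated : WheelEdge → WheelEdge → Set
    Separated u v =
      ∃ λ x → x ∈ W × ∃ λ a → ∃ λ b → Dist LineWheel u x a × Dist LineWheel v x b × a ≢ b

    separated-sym : ∀ {u v} → Separated u v → Separated v u
    separated-sym (x , x∈W , a , b , da , db , a≢b) = x , x∈W , b , a , db , da , λ e → a≢b (sym e)

    separated-by-self : ∀ {x v} → x ∈ W → v ≢ x → Separated x v
    separated-by-self {x} {v} x∈W v≢x with dist v x
    ... | b , db = x , x∈W , 0 , b , dist-0 , db , λ { refl → v≢x (walk₀⇒≡ (proj₁ db)) }

    separated-by-neighbour : ∀ {u v x} → x ∈ W → Meet u x → ¬ Meet v x → v ≢ x → Separated u v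
    separated-by-neighbour {u} {v} {x} x∈W m ¬m v≢x with dist v x
    ... | b , db = x , x∈W , 1 , b , dist-1 (meet⇒≢ m) m , db , 1≢b
      where
      1≢b : 1 ≢ b
      1≢b refl = ¬m (walk₁⇒adj (proj₁ db))

    separated-by-far : ∀ {u c y} → rim y ∈ W → Far u (rim y) → Separated u (spoke c)
    separated-by-far {u} {c} {y} y∈W (u≢y , ¬m , ¬w)
      with dist u (rim y) | dist (spoke c) (rim y) | spoke-near-rim c y
    ... | a , da | b , db | m , m≤2 , w = rim y , y∈W , a , b , da , db , a≢b a da
      where
      a≢b : ∀ a → Dist LineWheel u (rim y) a → a ≢ b
      a≢b zero da _ = u≢y (walk₀⇒≡ (proj₁ da))
      a≢b (suc zero) da _ = ¬m (walk₁⇒adj (proj₁ da))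
      a≢b (suc (suc zero)) da _ with walk₂⇒middle (proj₁ da)
      ... | w , p , q = ¬w w p q
      a≢b (suc (suc (suc a))) da refl with ≤-trans (proj₂ db m w) m≤2
      ... | s≤s (s≤s ())

    spokes-separated-by-rim : ∀ {a b} p → ¬ Gap p → Endpoint a p → ¬ Endpoint b p →
                              Separated (spoke a) (spoke b)
    spokes-separated-by-rim p ¬g e ¬e = separated-by-neighbour (rim∈W p ¬g) e ¬e (λ ())

    consecutive-spokes-separated : ∀ {a b} → a ⟶[ 1 ] b → Separated (spoke a) (spoke b)
    consecutive-spokes-separated {a} {b} s with gap? (prev a) | gap? b
    ... | no ¬g | _ = spokes-separated-by-rim (prev a) ¬g (inj₂ (⟶-prev a)) ¬e
      where
      ¬e : ¬ Endpoint b (prev a)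
      ¬e (inj₁ s′) = steps-clash s′ (⟶-trans (⟶-prev a) s)
      ¬e (inj₂ s′) = steps-clash s′ (⟶-trans (⟶-prev a) s)
    ... | yes _ | no ¬g = separated-sym (spokes-separated-by-rim b ¬g (endpoint-self b) ¬e)
      where
      ¬e : ¬ Endpoint a b
      ¬e (inj₁ s′) = steps-clash (⟶-trans s s′) (⟶-refl a)
      ¬e (inj₂ s′) = steps-clash (⟶-trans s s′) (⟶-refl a)
    ... | yes g | yes g′ = ⊥-elim (gaps-not-2-apart (⟶-trans (⟶-prev a) s) g g′)

    spokes-separated : ∀ a b → a ≢ b → Separated (spoke a) (spoke b)
    spokes-separated a b a≢b with a ⟶[ 1 ]? b | b ⟶[ 1 ]? a
    ... | yes s | _ = consecutive-spokes-separated s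
    ... | no _ | yes s = separated-sym (consecutive-spokes-separated s)
    ... | no ¬ab | no ¬ba with gap? a | gap? (prev a) | gap? b | gap? (prev b)
    ... | no ¬g | _ | _ | _ = spokes-separated-by-rim a ¬g (endpoint-self a) ¬e
      where
      ¬e : ¬ Endpoint b a
      ¬e (inj₁ s) = a≢b (⟶₀⇒≡ s)
      ¬e (inj₂ s) = ¬ab s
    ... | yes _ | no ¬g | _ | _ = spokes-separated-by-rim (prev a) ¬g (inj₂ (⟶-prev a)) ¬e
      where
      ¬e : ¬ Endpoint b (prev a)
      ¬e (inj₁ s) = ¬ba (subst (_⟶[ 1 ] a) (⟶₀⇒≡ s) (⟶-prev a))
      ¬e (inj₂ s) = a≢b (⟶-functional (⟶-prev a) s)
    ... | yes _ | yes _ | no ¬g | _ = separated-sym (spokes-separated-by-rim b ¬g (endpoint-self b) ¬e)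
      where
      ¬e : ¬ Endpoint a b
      ¬e (inj₁ s) = a≢b (sym (⟶₀⇒≡ s))
      ¬e (inj₂ s) = ¬ba s
    ... | yes _ | yes _ | yes _ | no ¬g =
      separated-sym (spokes-separated-by-rim (prev b) ¬g (inj₂ (⟶-prev b)) ¬e)
      where
      ¬e : ¬ Endpoint a (prev b)
      ¬e (inj₁ s) = ¬ab (subst (_⟶[ 1 ] b) (⟶₀⇒≡ s) (⟶-prev b))
      ¬e (inj₂ s) = a≢b (sym (⟶-functional (⟶-prev b) s))
    ... | yes g₁ | yes g₂ | yes g₃ | yes g₄ =
      ⊥-elim (a≢b (gap-pairs-unique (⟶-prev a) g₂ g₁ (⟶-prev b) g₄ g₃))

    -- If a neighbouring rim is also a gap, some landmark rim is at distance 3, while every spoke is within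
    -- distance 2 of every rim.
    gap-rim-separated-from-spoke : ∀ a q → Gap q → Separated (rim q) (spoke a)
    gap-rim-separated-from-spoke a q g with gap? (prev q) | gap? (next q)
    ... | yes g₁ | yes g₂ = ⊥-elim (gaps-not-2-apart (⟶-trans (⟶-prev q) (⟶-next q)) g₁ g₂)
    ... | yes g₁ | no _ =
      separated-by-far (rim∈W z ¬g) (far-sym (⟶₃⇒far (⟶-trans z⟶₂prev (⟶-prev q))))
      where
      z = shift (n ∸ 2) (prev q)
      z⟶₂prev : z ⟶[ 2 ] prev q
      z⟶₂prev = ⟶-shift⁻ 2 (prev q) (<⇒≤ (steps<n 2 _))
      ¬g : ¬ Gap z
      ¬g g′ = gaps-not-2-apart z⟶₂prev g′ g₁
    ... | no _ | yes g₂ =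
      separated-by-far (rim∈W z ¬g) (⟶₃⇒far (⟶-trans (⟶-next q) (⟶-shift 2 (next q))))
      where
      z = shift 2 (next q)
      ¬g : ¬ Gap z
      ¬g g′ = gaps-not-2-apart (⟶-shift 2 (next q)) g₂ g′
    ... | no ¬g₁ | no ¬g₂ with endpoint? a (next q)
    ...   | no ¬e = separated-by-neighbour (rim∈W (next q) ¬g₂) (inj₁ (⟶-next q)) ¬e (λ ())
    ...   | yes e = separated-by-neighbour (rim∈W (prev q) ¬g₁) (inj₂ (⟶-prev q)) (not-both e) (λ ())
      where
      prev⟶₂next = ⟶-trans (⟶-prev q) (⟶-next q)
      not-both : Endpoint a (next q) → ¬ Endpoint a (prev q)
      not-both (inj₁ s′) (inj₁ s) = steps-clash (⟶-trans prev⟶₂next s′) s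
      not-both (inj₁ s′) (inj₂ s) = steps-clash (⟶-trans prev⟶₂next s′) s
      not-both (inj₂ s′) (inj₁ s) = steps-clash (⟶-trans prev⟶₂next s′) s
      not-both (inj₂ s′) (inj₂ s) = steps-clash (⟶-trans prev⟶₂next s′) s

    gap-rims-separated : ∀ p q → Gap p → Gap q → p ≢ q → Separated (rim p) (rim q)
    gap-rims-separated p q g g′ p≢q with gap? (next p) | gap? (prev p)
    ... | no ¬g | _ =
      separated-by-neighbour (rim∈W (next p) ¬g) (inj₁ (⟶-next p)) ¬m (λ e → ¬g (subst Gap (rim-injective e) g′))
      where
      ¬m : ¬ Meet (rim q) (rim (next p))
      ¬m (inj₁ s) = p≢q (sym (⟶-source-unique s (⟶-next p)))
      ¬m (inj₂ s) = gaps-not-2-apart (⟶-trans (⟶-next p) s) g g′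
    ... | yes _ | no ¬g =
      separated-by-neighbour (rim∈W (prev p) ¬g) (inj₂ (⟶-prev p)) ¬m (λ e → ¬g (subst Gap (rim-injective e) g′))
      where
      ¬m : ¬ Meet (rim q) (rim (prev p))
      ¬m (inj₁ s) = gaps-not-2-apart (⟶-trans s (⟶-prev p)) g′ g
      ¬m (inj₂ s) = p≢q (sym (⟶-functional s (⟶-prev p)))
    ... | yes g₁ | yes g₂ = ⊥-elim (gaps-not-2-apart (⟶-trans (⟶-prev p) (⟶-next p)) g₂ g₁)

    rims-resolving : Resolving LineWheel W
    rims-resolving (spoke a) (spoke b) x≢y = spokes-separated a b (λ e → x≢y (cong spoke e))
    rims-resolving (spoke a) (rim q) x≢y with gap? q
    ... | no ¬g = separated-sym (separated-by-self (rim∈W q ¬g) x≢y)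
    ... | yes g = separated-sym (gap-rim-separated-from-spoke a q g)
    rims-resolving (rim p) (spoke a) x≢y with gap? p
    ... | no ¬g = separated-by-self (rim∈W p ¬g) (λ e → x≢y (sym e))
    ... | yes g = gap-rim-separated-from-spoke a p g
    rims-resolving (rim p) (rim q) x≢y with gap? p | gap? q
    ... | no ¬g | _ = separated-by-self (rim∈W p ¬g) (λ e → x≢y (sym e))
    ... | yes _ | no ¬g = separated-sym (separated-by-self (rim∈W q ¬g) x≢y)
    ... | yes g | yes g′ = gap-rims-separated p q g g′ (λ e → x≢y (cong rim e))

  k r : ℕ
  k = n / 3
  r = n % 3

  n≡r+k*3 : n ≡ r + k * 3
  n≡r+k*3 = m≡m%n+[m/n]*n n 3

  r<3 : r < 3
  r<3 = m%n<n n 3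

  2≤k*3 : 2 ≤ k * 3
  2≤k*3 = ≤-trans (s≤s (s≤s z≤n)) (*-monoˡ-≤ 3 (m≥n⇒m/n>0 (≤-trans (s≤s (s≤s (s≤s z≤n))) 6≤n)))

  -- The omitted rims; the second clause is vacuous when 3 ∣ n.
  IsGap : ℕ → Set
  IsGap t = t % 3 ≡ 2 ⊎ t ≡ k * 3

  Gap : Fin n → Set
  Gap p = IsGap (toℕ p)

  gap? : ∀ p → Dec (Gap p)
  gap? p = (toℕ p % 3 ≟ 2) ⊎-dec (toℕ p ≟ k * 3)

  [t+c]%3≡[i+c]%3 : ∀ t c {i} → t % 3 ≡ i → (t + c) % 3 ≡ (i + c) % 3
  [t+c]%3≡[i+c]%3 t c {i} t%3≡i = begin
    (t + c) % 3              ≡⟨ %-distribˡ-+ t c 3 ⟩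
    (t % 3 + c % 3) % 3      ≡⟨ cong (λ z → (z + c % 3) % 3) (m%n%n≡m%n t 3) ⟨
    (t % 3 % 3 + c % 3) % 3  ≡⟨ %-distribˡ-+ (t % 3) c 3 ⟨
    (t % 3 + c) % 3          ≡⟨ cong (λ z → (z + c) % 3) t%3≡i ⟩
    (i + c) % 3              ∎
    where open ≡-Reasoning

  <2⇒¬gap : ∀ {t} → t < 2 → ¬ IsGap t
  <2⇒¬gap {0} _ (inj₁ ())
  <2⇒¬gap {1} _ (inj₁ ())
  <2⇒¬gap {suc (suc _)} (s≤s (s≤s ())) _
  <2⇒¬gap t<2 (inj₂ t≡k*3) = <⇒≱ (subst (_< 2) t≡k*3 t<2) 2≤k*3

  %3≡1⇒¬gap : ∀ {t} → t % 3 ≡ 1 → ¬ IsGap t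
  %3≡1⇒¬gap t%3≡1 (inj₁ t%3≡2) = case trans (sym t%3≡1) t%3≡2 of λ ()
  %3≡1⇒¬gap t%3≡1 (inj₂ refl) = case trans (sym t%3≡1) (m*n%n≡0 k 3) of λ ()

  k*3+c<n⇒c<r : ∀ {c} → k * 3 + c < n → c < r
  k*3+c<n⇒c<r {c} lt = +-cancelʳ-< (k * 3) c r (subst₂ _<_ (+-comm (k * 3) c) n≡r+k*3 lt)

  wrapped⇒< : ∀ {a b c} → a < n → a + c ≡ b + n → b < c
  wrapped⇒< {a} {b} {c} a<n e = +-cancelʳ-< n b c (subst₂ _<_ e (+-comm n c) (+-monoˡ-< c a<n))

  gaps-not-2-apart : ∀ {x y} → x ⟶[ 2 ] y → Gap x → Gap y → ⊥
  gaps-not-2-apart {x} {y} s gx gy with ⟶-unfold s (steps<n 2 _)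
  ... | inj₂ e = <2⇒¬gap (wrapped⇒< (toℕ<n x) e) gy
  ... | inj₁ e with gx
  ...   | inj₁ x%3≡2 = %3≡1⇒¬gap (trans (cong (_% 3) (sym e)) ([t+c]%3≡[i+c]%3 (toℕ x) 2 x%3≡2)) gy
  ...   | inj₂ x≡k*3 =
    <⇒≱ (k*3+c<n⇒c<r (subst (_< n) (trans (sym e) (cong (_+ 2) x≡k*3)) (toℕ<n y))) (≤-pred r<3)

  consecutive-gaps-end-at-k*3 : ∀ {x y} → x ⟶[ 1 ] y → Gap x → Gap y → toℕ y ≡ k * 3
  consecutive-gaps-end-at-k*3 {x} {y} s gx gy with ⟶-unfold s (steps<n 1 _)
  ... | inj₂ e = ⊥-elim (<2⇒¬gap (<-≤-trans (wrapped⇒< (toℕ<n x) e) (s≤s z≤n)) gy)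
  ... | inj₁ e with gy
  ...   | inj₂ y≡k*3 = y≡k*3
  ...   | inj₁ y%3≡2 with gx
  ...     | inj₁ x%3≡2 = case trans (sym y%3≡2) (trans (cong (_% 3) (sym e)) ([t+c]%3≡[i+c]%3 (toℕ x) 1 x%3≡2)) of λ ()
  ...     | inj₂ x≡k*3 = case trans (sym y%3≡2) (trans (cong (_% 3) (sym e))
                              ([t+c]%3≡[i+c]%3 (toℕ x) 1 (trans (cong (_% 3) x≡k*3) (m*n%n≡0 k 3)))) of λ ()

  gap-pairs-unique : ∀ {x y x′ y′} → x ⟶[ 1 ] y → Gap x → Gap y →
                     x′ ⟶[ 1 ] y′ → Gap x′ → Gap y′ → y ≡ y′
  gap-pairs-unique s gx gy s′ gx′ gy′ =
    toℕ-injective (trans (consecutive-gaps-end-at-k*3 s gx gy)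
                         (sym (consecutive-gaps-end-at-k*3 s′ gx′ gy′)))

  pairs : ℕ → List ℕ
  pairs zero = []
  pairs (suc j) = suc (j * 3) ∷ j * 3 ∷ pairs j

  extra : ℕ → List ℕ
  extra 2 = suc (k * 3) ∷ []
  extra _ = []

  landmarkIndices : List ℕ
  landmarkIndices = extra r ++ pairs k

  toFin : ℕ → Fin n
  toFin t = fromℕ< (m%n<n t n)

  toℕ-toFin : ∀ {t} → t < n → toℕ (toFin t) ≡ t
  toℕ-toFin t<n = trans (toℕ-fromℕ< _) (m<n⇒m%n≡m t<n)

  toFin-injective : ∀ {s t} → s < n → t < n → toFin s ≡ toFin t → s ≡ t
  toFin-injective s<n t<n e = trans (sym (toℕ-toFin s<n)) (trans (cong toℕ e) (toℕ-toFin t<n))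

  landmarks : List WheelEdge
  landmarks = map (rim ∘ toFin) landmarkIndices

  length-landmarks : length landmarks ≡ n * 2 / 3
  length-landmarks = begin
    length landmarks                   ≡⟨ length-map (rim ∘ toFin) landmarkIndices ⟩
    length landmarkIndices             ≡⟨ length-++ (extra r) ⟩
    length (extra r) + length (pairs k) ≡⟨ cong₂ _+_ (length-extra r r<3) (length-pairs k) ⟩
    r * 2 / 3 + k * 2                  ≡⟨ cong (r * 2 / 3 +_) (m*n/n≡m (k * 2) 3) ⟨
    r * 2 / 3 + k * 2 * 3 / 3          ≡⟨ +-distrib-/-∣ʳ (r * 2) (divides (k * 2) refl) ⟨
    (r * 2 + k * 2 * 3) / 3            ≡⟨ cong (_/ 3) (distrib r k) ⟩
    (r + k * 3) * 2 / 3                ≡⟨ cong (λ m → m * 2 / 3) n≡r+k*3 ⟨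
    n * 2 / 3                          ∎
    where
    open ≡-Reasoning
    distrib : ∀ r k → r * 2 + k * 2 * 3 ≡ (r + k * 3) * 2
    distrib = solve 2 (λ r k → r :* con 2 :+ k :* con 2 :* con 3 := (r :+ k :* con 3) :* con 2) refl
    length-pairs : ∀ j → length (pairs j) ≡ j * 2
    length-pairs zero = refl
    length-pairs (suc j) = cong (λ z → suc (suc z)) (length-pairs j)
    length-extra : ∀ r → r < 3 → length (extra r) ≡ r * 2 / 3
    length-extra 0 _ = refl
    length-extra 1 _ = refl
    length-extra 2 _ = refl
    length-extra (suc (suc (suc _))) (s≤s (s≤s (s≤s ())))

  pairs-< : ∀ j → All (_< j * 3) (pairs j)
  pairs-< zero = []
  pairs-< (suc j) =
    s≤s (s≤s (n≤1+n _)) ∷ m<n+m (j * 3) {3} (s≤s z≤n) ∷ All.map (λ t< → <-≤-trans t< (m≤n+m (j * 3) 3)) (pairs-< j)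

  pairs-descending : ∀ j → AllPairs _>_ (pairs j)
  pairs-descending zero = []
  pairs-descending (suc j) = (n<1+n _ ∷ All.map m<n⇒m<1+n (pairs-< j)) ∷ pairs-< j ∷ pairs-descending j

  landmarkIndices-descending : AllPairs _>_ landmarkIndices
  landmarkIndices-descending = descending r
    where
    descending : ∀ r → AllPairs _>_ (extra r ++ pairs k)
    descending 0 = pairs-descending k
    descending 1 = pairs-descending k
    descending 2 = All.map m<n⇒m<1+n (pairs-< k) ∷ pairs-descending k
    descending (suc (suc (suc _))) = pairs-descending k

  landmarkIndices-<n : All (_< n) landmarkIndices
  landmarkIndices-<n = below r refl
    where
    k*3≤n : k * 3 ≤ n
    k*3≤n = subst (k * 3 ≤_) (sym n≡r+k*3) (m≤n+m (k * 3) r)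
    pairs-<n : All (_< n) (pairs k)
    pairs-<n = All.map (λ t< → <-≤-trans t< k*3≤n) (pairs-< k)
    below : ∀ r′ → r′ ≡ r → All (_< n) (extra r′ ++ pairs k)
    below 0 _ = pairs-<n
    below 1 _ = pairs-<n
    below 2 2≡r = subst (suc (k * 3) <_) (trans (cong (_+ k * 3) 2≡r) (sym n≡r+k*3)) ≤-refl ∷ pairs-<n
    below (suc (suc (suc _))) _ = pairs-<n

  landmarks-unique : Unique landmarks
  landmarks-unique = AllPairs.map⁺ (distinct landmarkIndices-<n landmarkIndices-descending)
    where
    distinct : ∀ {xs} → All (_< n) xs → AllPairs _>_ xs → AllPairs (λ s t → rim (toFin s) ≢ rim (toFin t)) xs
    distinct [] [] = []
    distinct {s ∷ _} (s<n ∷ <n) (s> ∷ desc) =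
      All.zipWith (λ (t<n , t<s) e → <-irrefl (toFin-injective t<n s<n (rim-injective (sym e))) t<s) (<n , s>) ∷
      distinct <n desc

  ∈-pairs : ∀ j q i → q < j → i < 2 → i + q * 3 ∈ pairs j
  ∈-pairs (suc j) q i q<1+j i<2 with m<1+n⇒m<n∨m≡n q<1+j
  ... | inj₁ q<j = there (there (∈-pairs j q i q<j i<2))
  ∈-pairs (suc j) q 0 _ _ | inj₂ refl = there (here refl)
  ∈-pairs (suc j) q 1 _ _ | inj₂ refl = here refl
  ∈-pairs (suc j) q (suc (suc _)) _ (s≤s (s≤s ())) | inj₂ refl

  ∈-landmarkIndices : ∀ t → t < n → ¬ IsGap t → t ∈ landmarkIndices
  ∈-landmarkIndices t t<n ¬g with t / 3 <? k
  ... | yes q<k =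
    ∈-++⁺ʳ (extra r) (subst (_∈ pairs k) (sym (m≡m%n+[m/n]*n t 3)) (∈-pairs k (t / 3) (t % 3) q<k t%3<2))
    where t%3<2 = ≤∧≢⇒< (≤-pred (m%n<n t 3)) (¬g ∘ inj₁)
  ... | no q≮k = ∈-++⁺ˡ (subst (_∈ extra r) (sym t≡1+k*3) (∈-extra r r<3 1<r))
    where
    t≡ : t ≡ t % 3 + k * 3
    t≡ = trans (m≡m%n+[m/n]*n t 3)
               (cong (λ q → t % 3 + q * 3) (≤-antisym (/-monoˡ-≤ 3 (<⇒≤ t<n)) (≮⇒≥ q≮k)))
    t%3≡1 : t % 3 ≡ 1
    t%3≡1 with m<1+n⇒m<n∨m≡n (≤∧≢⇒< (≤-pred (m%n<n t 3)) (¬g ∘ inj₁))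
    ... | inj₁ t%3<1 = ⊥-elim (¬g (inj₂ (trans t≡ (cong (_+ k * 3) (n<1⇒n≡0 t%3<1)))))
    ... | inj₂ t%3≡1 = t%3≡1
    t≡1+k*3 : t ≡ suc (k * 3)
    t≡1+k*3 = trans t≡ (cong (_+ k * 3) t%3≡1)
    1<r : 1 < r
    1<r = k*3+c<n⇒c<r (subst (_< n) (trans t≡1+k*3 (+-comm 1 (k * 3))) t<n)
    ∈-extra : ∀ r → r < 3 → 1 < r → suc (k * 3) ∈ extra r
    ∈-extra 1 _ (s≤s ())
    ∈-extra 2 _ _ = here refl
    ∈-extra (suc (suc (suc _))) (s≤s (s≤s (s≤s ()))) _

  rim∈landmarks : ∀ p → ¬ Gap p → rim p ∈ landmarks
  rim∈landmarks p ¬g =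
    subst (_∈ landmarks) (cong rim (toℕ-injective (toℕ-toFin (toℕ<n p))))
      (∈-map⁺ (rim ∘ toFin) (∈-landmarkIndices (toℕ p) (toℕ<n p) ¬g))

  landmarks-resolving : Resolving LineWheel landmarks
  landmarks-resolving =
    RimLandmarks.rims-resolving Gap gap? gaps-not-2-apart gap-pairs-unique landmarks rim∈landmarks

  -- Lower bound

  Touches : WheelEdge → Fin n → Set
  Touches (spoke c) a = c ≡ a
  Touches (rim p) a = Endpoint a p

  next∘prev : ∀ a → next (prev a) ≡ a
  next∘prev a = ⟶-functional (⟶-next (prev a)) (⟶-prev a)

  touching : ∀ {x a} → Touches x a → x ≡ spoke a ⊎ x ≡ rim a ⊎ x ≡ rim (prev a)
  touching {spoke c} refl = inj₁ refl
  touching {rim p} (inj₁ s) = inj₂ (inj₁ (cong rim (⟶₀⇒≡ s)))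
  touching {rim p} (inj₂ s) = inj₂ (inj₂ (cong rim (⟶-source-unique s (⟶-prev _))))

  module LowerBound (W : List WheelEdge) (R : Resolving LineWheel W) where

    open import Data.List.Membership.DecPropositional _≟ᵉ_ using (_∈?_)

    same-trace⇒≡ : ∀ a b → (∀ x → x ∈ W → Touches x a ⇔ Touches x b) → a ≡ b
    same-trace⇒≡ a b trace with a ≟ᶠ b
    ... | yes a≡b = a≡b
    ... | no a≢b with R (spoke a) (spoke b) (a≢b ∘ spoke-injective)
    ... | x , x∈W , α , β , dα , dβ , α≢β = ⊥-elim (α≢β (same-distance x (trace x x∈W) dα dβ))
      where
      same-distance : ∀ x → Touches x a ⇔ Touches x b →
                      Dist LineWheel (spoke a) x α → Dist LineWheel (spoke b) x β → α ≡ β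
      same-distance (spoke c) t dα dβ with c ≟ᶠ a | c ≟ᶠ b
      ... | yes c≡a | _ = ⊥-elim (a≢b (trans (sym c≡a) (Equivalence.to t c≡a)))
      ... | no _ | yes c≡b = ⊥-elim (a≢b (trans (sym (Equivalence.from t c≡b)) c≡b))
      ... | no c≢a | no c≢b =
        trans (dist-unique dα (dist-1 (c≢a ∘ sym ∘ spoke-injective) (c≢a ∘ sym)))
              (dist-unique (dist-1 (c≢b ∘ sym ∘ spoke-injective) (c≢b ∘ sym)) dβ)
      same-distance (rim p) t dα dβ with endpoint? a p
      ... | yes e =
        trans (dist-unique dα (dist-1 (λ ()) e)) (dist-unique (dist-1 (λ ()) (Equivalence.to t e)) dβ)
      ... | no ¬e =
        trans (dist-unique dα (via-spoke ¬e)) (dist-unique (via-spoke (¬e ∘ Equivalence.from t)) dβ)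
        where
        via-spoke : ∀ {c} → ¬ Endpoint c p → Dist LineWheel (spoke c) (rim p) 2
        via-spoke ¬e = dist-2 (λ ()) ¬e (¬endpoint⇒spokes-meet ¬e) (endpoint-self p)

    Slot : Set
    Slot = (Fin (length W) × Fin 3) ⊎ Fin 2

    -- Cycle vertex a charges slots 0 and 1 of its spoke if that is a landmark, otherwise slot 0 of r_a
    -- and slot 1 of r_(a-1) as far as these are landmarks. Slot 2 of a rim, and the spare slots, are charged
    -- only when that rim, resp. nothing, is the whole trace of a: a is then pinned down by its trace.
    code : ∀ a → Dec (spoke a ∈ W) → Dec (rim a ∈ W) → Dec (rim (prev a) ∈ W) → Fin 2 → Slot
    code a (yes s) _       _       t = inj₁ (index s , inject₁ t)
    code a (no _)  (yes q) (yes p) 0F = inj₁ (index q , 0F)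
    code a (no _)  (yes q) (yes p) 1F = inj₁ (index p , 1F)
    code a (no _)  (yes q) (no _)  0F = inj₁ (index q , 0F)
    code a (no _)  (yes q) (no _)  1F = inj₁ (index q , 2F)
    code a (no _)  (no _)  (yes p) 0F = inj₁ (index p , 1F)
    code a (no _)  (no _)  (yes p) 1F = inj₁ (index p , 2F)
    code a (no _)  (no _)  (no _)  t = inj₂ t

    decodeEdge : WheelEdge → Fin 3 → Maybe (Fin n)
    decodeEdge (spoke c) 2F = nothing
    decodeEdge (spoke c) _  = just c
    decodeEdge (rim p)   0F = just p
    decodeEdge (rim p)   1F = just (next p)
    decodeEdge (rim p)   2F = nothing

    decode : Slot → Maybe (Fin n)
    decode (inj₁ (i , u)) = decodeEdge (lookup W i) u
    decode (inj₂ _) = nothing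

    Pins : Slot → Fin n → Set
    Pins (inj₁ (i , 2F)) a = ∀ x → x ∈ W → Touches x a ⇔ x ≡ lookup W i
    Pins (inj₂ _)        a = ∀ x → x ∈ W → ¬ Touches x a
    Pins _               _ = ⊥

    pins⇒nothing : ∀ σ a → Pins σ a → decode σ ≡ nothing
    pins⇒nothing (inj₁ (i , 2F)) a _ with lookup W i
    ... | spoke _ = refl
    ... | rim _ = refl
    pins⇒nothing (inj₂ _) a _ = refl

    pins-unique : ∀ σ a b → Pins σ a → Pins σ b → a ≡ b
    pins-unique (inj₁ (i , 2F)) a b πa πb = same-trace⇒≡ a b λ x x∈W →
      mk⇔ (Equivalence.from (πb x x∈W) ∘ Equivalence.to (πa x x∈W))
          (Equivalence.from (πa x x∈W) ∘ Equivalence.to (πb x x∈W))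
    pins-unique (inj₂ _) a b πa πb =
      same-trace⇒≡ a b λ x x∈W → mk⇔ (⊥-elim ∘ πa x x∈W) (⊥-elim ∘ πb x x∈W)

    pins-rim : ∀ {a p} (q : rim p ∈ W) → Touches (rim p) a → (∀ x → x ∈ W → Touches x a → x ≡ rim p) →
               Pins (inj₁ (index q , 2F)) a
    pins-rim {a} q t only x x∈W =
      mk⇔ (λ tx → trans (only x x∈W tx) (lookup-index q))
          (λ x≡ → subst (λ y → Touches y a) (trans (lookup-index q) (sym x≡)) t)

    decodes-or-pins : ∀ a d₁ d₂ d₃ t →
                      decode (code a d₁ d₂ d₃ t) ≡ just a ⊎ Pins (code a d₁ d₂ d₃ t) a
    decodes-or-pins a (yes s) _ _ 0F = inj₁ (cong (λ x → decodeEdge x 0F) (sym (lookup-index s)))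
    decodes-or-pins a (yes s) _ _ 1F = inj₁ (cong (λ x → decodeEdge x 1F) (sym (lookup-index s)))
    decodes-or-pins a (no _) (yes q) (yes p) 0F = inj₁ (cong (λ x → decodeEdge x 0F) (sym (lookup-index q)))
    decodes-or-pins a (no _) (yes q) (yes p) 1F =
      inj₁ (trans (cong (λ x → decodeEdge x 1F) (sym (lookup-index p))) (cong just (next∘prev a)))
    decodes-or-pins a (no _) (yes q) (no _) 0F = inj₁ (cong (λ x → decodeEdge x 0F) (sym (lookup-index q)))
    decodes-or-pins a (no ¬s) (yes q) (no ¬p) 1F = inj₂ (pins-rim q (endpoint-self a) only)
      where
      only : ∀ x → x ∈ W → Touches x a → x ≡ rim a
      only x x∈W t with touching t
      ... | inj₁ refl = contradiction x∈W ¬s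
      ... | inj₂ (inj₁ refl) = refl
      ... | inj₂ (inj₂ refl) = contradiction x∈W ¬p
    decodes-or-pins a (no _) (no _) (yes p) 0F =
      inj₁ (trans (cong (λ x → decodeEdge x 1F) (sym (lookup-index p))) (cong just (next∘prev a)))
    decodes-or-pins a (no ¬s) (no ¬q) (yes p) 1F = inj₂ (pins-rim p (inj₂ (⟶-prev a)) only)
      where
      only : ∀ x → x ∈ W → Touches x a → x ≡ rim (prev a)
      only x x∈W t with touching t
      ... | inj₁ refl = contradiction x∈W ¬s
      ... | inj₂ (inj₁ refl) = contradiction x∈W ¬q
      ... | inj₂ (inj₂ refl) = refl
    decodes-or-pins a (no ¬s) (no ¬q) (no ¬p) t = inj₂ none
      where
      none : ∀ x → x ∈ W → ¬ Touches x a
      none x x∈W t with touching t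
      ... | inj₁ refl = ¬s x∈W
      ... | inj₂ (inj₁ refl) = ¬q x∈W
      ... | inj₂ (inj₂ refl) = ¬p x∈W

    slot : Fin n → Fin 2 → Slot
    slot a = code a (spoke a ∈? W) (rim a ∈? W) (rim (prev a) ∈? W)

    rank : Slot → ℕ
    rank (inj₁ (_ , u)) = toℕ u
    rank (inj₂ t) = toℕ t

    slot-ranks-differ : ∀ a → rank (slot a 0F) ≢ rank (slot a 1F)
    slot-ranks-differ a with spoke a ∈? W | rim a ∈? W | rim (prev a) ∈? W
    ... | yes _ | _     | _     = λ ()
    ... | no _  | yes _ | yes _ = λ ()
    ... | no _  | yes _ | no _  = λ ()
    ... | no _  | no _  | yes _ = λ ()
    ... | no _  | no _  | no _  = λ ()

    slot-decodes-or-pins : ∀ a t → decode (slot a t) ≡ just a ⊎ Pins (slot a t) a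
    slot-decodes-or-pins a = decodes-or-pins a (spoke a ∈? W) (rim a ∈? W) (rim (prev a) ∈? W)

    slot-injective : ∀ {a b t u} → slot a t ≡ slot b u → (a , t) ≡ (b , u)
    slot-injective {a} {b} {t} {u} e with a≡b
      where
      a≡b : a ≡ b
      a≡b with slot-decodes-or-pins a t | slot-decodes-or-pins b u
      ... | inj₁ da | inj₁ db = just-injective (trans (sym da) (trans (cong decode e) db))
      ... | inj₁ da | inj₂ πb = case trans (sym da) (trans (cong decode e) (pins⇒nothing _ b πb)) of λ ()
      ... | inj₂ πa | inj₁ db = case trans (sym db) (trans (cong decode (sym e)) (pins⇒nothing _ a πa)) of λ ()
      ... | inj₂ πa | inj₂ πb = pins-unique (slot b u) a b (subst (λ σ → Pins σ a) e πa) πb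
    ... | refl = cong (a ,_) (t≡u t u e)
      where
      t≡u : ∀ t u → slot a t ≡ slot a u → t ≡ u
      t≡u 0F 0F _ = refl
      t≡u 1F 1F _ = refl
      t≡u 0F 1F e′ = ⊥-elim (slot-ranks-differ a (cong rank e′))
      t≡u 1F 0F e′ = ⊥-elim (slot-ranks-differ a (cong rank (sym e′)))

    n*2≤|W|*3+2 : n * 2 ≤ length W * 3 + 2
    n*2≤|W|*3+2 = injective⇒≤ {f = toFin-×⊎ ∘ uncurry slot ∘ remQuot {n} 2} λ {i} {j} e →
      trans (sym (combine-remQuot {n} 2 i))
        (trans (cong (uncurry combine) (slot-injective (toFin-×⊎-injective _ _ e))) (combine-remQuot {n} 2 j))

    resolving-lower-bound : n ∸ ceil3 n ≤ length W
    resolving-lower-bound = begin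
      n ∸ ceil3 n               ≡⟨ n∸ceil3≡n*2/3 n ⟩
      n * 2 / 3                 ≤⟨ /-monoˡ-≤ 3 n*2≤|W|*3+2 ⟩
      (length W * 3 + 2) / 3    ≡⟨ [m*3+2]/3≡m (length W) ⟩
      length W                  ∎
      where open ≤-Reasoning

theorem2p9 : ∀ (n : ℕ) → 6 ≤ n → MetricDim (LineGraph (Wheel n)) (n ∸ ceil3 n)
theorem2p9 n 6≤n = metricDim-≅ lineGraph≅LineWheel (n ∸ ceil3 n)
  ( (landmarks , landmarks-unique , landmarks-resolving , trans length-landmarks (sym (n∸ceil3≡n*2/3 n)))
  , λ W _ R → LowerBound.resolving-lower-bound W R )
  where open WheelLineGraph n 6≤n
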